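{- Let $p$ be a prime and let $X$ be an infinite transitive $G$-graph with $G'\cong\mathbb{Z}_p$. Let $\overline{\gamma}:\ldots,\overline{v}_{ -1},\overline{v}_0,\overline{v}_1,\ldots$ be a two-way hamiltonian path in $X/G'$, let $(v_i)_{i\in\mathbb{Z}}$ be a lifting of $\overline{\gamma}$ (so $v_i\in\pi^{ -1}(\overline{v}_i)$ and $v_i$ is adjacent to $v_{i+1}$ in $X$), and let $(e_\ell)_{\ell\in\mathbb{Z}}$ be a sequence of edges of $X/G'$ aligned with $\overline{\gamma}$ such that each $e_\ell$ is bouncing, i.e. writing $e_\ell=(\overline{v}_a,\overline{v}_b)$ with $a<b$, there exist $h\neq h'$ in $G'$ such that $hv_a$ is adjacent to $h'v_b$ in $X$. Then every block $B(e_\ell)$ of $X$ has a hamiltonian cycle containing some bouncing edge, i.e. an edge of the form $(hv_a,h'v_b)$ with $h,h'\in G'$, $h\neq h'$.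
   Context: A $G$-graph is a graph $X$ with an injective homomorphism $G\to\mathrm{Aut}(X)$; it is transitive if $G$ acts transitively on $V(X)$. $G'$ is the commutator subgroup. The quotient $X/G'$ has the $G'$-orbits as vertices, two orbits adjacent iff some edge of $X$ joins them; $\pi:X\to X/G'$ is the quotient map. A two-way hamiltonian path is a two-way infinite sequence of vertices containing every vertex exactly once with consecutive vertices adjacent. A sequence $(e_\ell=(x_\ell,y_\ell))_{\ell\in\mathbb{Z}}$ of edges of $X/G'$ is aligned with $\overline{\gamma}$ if no $e_\ell$ is an edge of $\overline{\gamma}$ and for every $\ell$ there are $j\in\mathbb{Z}$, $k\geq1$ with $x_\ell=\overline{v}_j$, $y_\ell=\overline{v}_{j+k}$ and $x_{\ell+1}=\overline{v}_{j+k+1}$. For $e_\ell=(\overline{v}_a,\overline{v}_b)$, $a<b$, the block $B(e_\ell)$ is the subgraph of $X$ induced on $\bigcup_{a\le i\le b}\pi^{ -1}(\overline{v}_i)$; its entrance is $\pi^{ -1}(\overline{v}_a)$ and its exit is $\pi^{ -1}(\overline{v}_b)$. -}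

module Defs where

open import Level using (Level; _⊔_)
open import Algebra.Bundles using (Group)
open import Data.Nat using (ℕ; zero; suc; _≥_)
open import Data.Nat.DivMod using (_mod_)
open import Data.Nat.Primality using (Prime)
open import Data.Fin using (Fin; toℕ)
open import Data.Integer using (ℤ; _<_; _≤_) renaming (_+_ to _+ℤ_)
open import Data.Product using (Σ; _×_; ∃; ∃-syntax; _,_)
open import Data.Sum using (_⊎_)
open import Data.List using (List)
open import Data.List.Membership.Propositional using (_∈_)
open import Relation.Nullary using (¬_)
open import Relation.Binary.PropositionalEquality using (_≡_)
open import Function using (_⇔_)

addMod : ∀ {p} → Fin p → Fin p → Fin p
addMod {suc n} a b = (toℕ a Data.Nat.+ toℕ b) mod suc n

cycSucc : ∀ {n} → Fin n → Fin n
cycSucc {suc n} i = suc (toℕ i) mod suc n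

record IsSimpleGraph {v e} {V : Set v} (E : V → V → Set e) : Set (v ⊔ e) where
  field
    sym   : ∀ {x y} → E x y → E y x
    irrefl : ∀ {x} → ¬ E x x

Infinite : ∀ {v} → Set v → Set v
Infinite V = ¬ (Σ (List V) λ xs → ∀ x → x ∈ xs)

module Setting {c ℓ v e} (G : Group c ℓ) {V : Set v} (E : V → V → Set e)
                (act : Group.Carrier G → V → V) where
  open Group G

  -- G → Aut(X) is an injective homomorphism (a G-graph)
  record IsGGraph : Set (c ⊔ ℓ ⊔ v ⊔ e) where
    field
      act-resp  : ∀ {g h} → g ≈ h → ∀ x → act g x ≡ act h x
      act-ε     : ∀ x → act ε x ≡ x
      act-∙     : ∀ g h x → act (g ∙ h) x ≡ act g (act h x)
      act-adj   : ∀ g {x y} → E x y ⇔ E (act g x) (act g y)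
      act-inj   : ∀ g h → (∀ x → act g x ≡ act h x) → g ≈ h

  Transitive : Set (c ⊔ v)
  Transitive = ∀ x y → ∃[ g ] act g x ≡ y

  data InG' : Carrier → Set (c ⊔ ℓ) where
    comm  : ∀ g h → InG' (g ⁻¹ ∙ h ⁻¹ ∙ g ∙ h)
    unit  : InG' ε
    mul   : ∀ {g h} → InG' g → InG' h → InG' (g ∙ h)
    inv   : ∀ {g} → InG' g → InG' (g ⁻¹)
    resp  : ∀ {g h} → g ≈ h → InG' g → InG' h

  G'≅ℤ : ℕ → Set (c ⊔ ℓ)
  G'≅ℤ p = Σ (Fin p → Carrier) λ φ →
      (∀ k → InG' (φ k))
    × (∀ g → InG' g → ∃[ k ] φ k ≈ g)
    × (∀ k m → φ k ≈ φ m → k ≡ m)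
    × (∀ k m → φ (addMod k m) ≈ φ k ∙ φ m)

  Orb : V → V → Set (c ⊔ ℓ ⊔ v)
  Orb x y = ∃[ h ] InG' h × act h x ≡ y

  QAdj : V → V → Set (c ⊔ ℓ ⊔ v ⊔ e)
  QAdj x y = ∃[ x' ] ∃[ y' ] Orb x x' × Orb y y' × E x' y'

  -- w is a two-way hamiltonian path of X/G' (w i a representative of the orbit v̄_i)
  record IsTwoWayHamPathQ (w : ℤ → V) : Set (c ⊔ ℓ ⊔ v ⊔ e) where
    field
      covers   : ∀ x → ∃[ i ] Orb (w i) x
      distinct : ∀ i j → Orb (w i) (w j) → i ≡ j
      adjacent : ∀ i → QAdj (w i) (w (i +ℤ Data.Integer.1ℤ))

  record IsLifting (w : ℤ → V) (vs : ℤ → V) : Set (c ⊔ ℓ ⊔ v ⊔ e) where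
    field
      inFibre  : ∀ i → Orb (w i) (vs i)
      adjacent : ∀ i → E (vs i) (vs (i +ℤ Data.Integer.1ℤ))

  -- the sequence e_ℓ = (v̄_{s ℓ}, v̄_{t ℓ}) of edges of X/G' is aligned with the path
  record IsAligned (w : ℤ → V) (s t : ℤ → ℤ) : Set (c ⊔ ℓ ⊔ v ⊔ e) where
    field
      isEdge   : ∀ l → QAdj (w (s l)) (w (t l))
      notPathEdge : ∀ l i →
        ¬ ((s l ≡ i × t l ≡ i +ℤ Data.Integer.1ℤ) ⊎ (t l ≡ i × s l ≡ i +ℤ Data.Integer.1ℤ))
      forward  : ∀ l → s l < t l
      next     : ∀ l → s (l +ℤ Data.Integer.1ℤ) ≡ t l +ℤ Data.Integer.1ℤ

  BouncingEdge : (vs : ℤ → V) (a b : ℤ) → V → V → Set (c ⊔ ℓ ⊔ v)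
  BouncingEdge vs a b x y = ∃[ h ] ∃[ h' ] InG' h × InG' h' × ¬ (h ≈ h')
                           × act h (vs a) ≡ x × act h' (vs b) ≡ y

  Bouncing : (vs : ℤ → V) (a b : ℤ) → Set (c ⊔ ℓ ⊔ v ⊔ e)
  Bouncing vs a b = ∃[ x ] ∃[ y ] BouncingEdge vs a b x y × E x y

  InBlock : (w : ℤ → V) (a b : ℤ) → V → Set (c ⊔ ℓ ⊔ v)
  InBlock w a b x = ∃[ i ] a ≤ i × i ≤ b × Orb (w i) x

  record HamCycleWithBouncing (w vs : ℤ → V) (a b : ℤ) : Set (c ⊔ ℓ ⊔ v ⊔ e) where
    field
      n        : ℕ
      n≥3      : n ≥ 3
      cyc      : Fin n → V
      injective : ∀ i j → cyc i ≡ cyc j → i ≡ j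
      spans    : ∀ x → InBlock w a b x ⇔ (∃[ i ] cyc i ≡ x)
      edges    : ∀ i → E (cyc i) (cyc (cycSucc i))
      bouncing : ∃[ i ] (BouncingEdge vs a b (cyc i) (cyc (cycSucc i))
                         ⊎ BouncingEdge vs a b (cyc (cycSucc i)) (cyc i))

{-# OPTIONS --safe #-}
-- The commutator subgroup G' ≅ ℤ_p acts freely on X: a nontrivial element of G' generates G', so if it
-- fixed a vertex y then all of G' would fix y; since G' is normal, the vertices fixed by G' form a
-- G-invariant set, so by transitivity G' would fix every vertex, contradicting faithfulness. Hence the
-- block over v̄_a, …, v̄_b consists of the distinct vertices h v_i (h ∈ G', a ≤ i ≤ b).
--
-- A bouncing edge (h v_a, h' v_b) gives u = h'⁻¹ h ≠ 1 and, translated by g h'⁻¹, edges g v_b — g u v_a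
-- for every g. The cycle follows the lift v_a … v_b, jumps to u v_a, follows u v_a … u v_b, jumps to
-- u² v_a, and so on. As u generates G' ≅ ℤ_p, the rounds u^r (r < p) are distinct and exhaust G', and
-- u^p = 1 closes the cycle; the jump v_b — u v_a is a bouncing edge on it.
module Submission where

open import Algebra.Bundles using (Group)
import Algebra.Properties.Group as GroupProperties
open import Data.Nat using (ℕ; zero; suc; _+_; _*_; _<_; _≤_; s≤s; z<s; NonZero; ≢-nonZero; nonTrivial⇒n>1)
import Data.Nat.Properties as ℕ
open import Data.Nat.DivMod
open import Data.Nat.Divisibility using (n∣m*n)
open import Data.Nat.Primality using (Prime; prime⇒nonTrivial; ¬prime[0]; ¬prime[1])
open import Data.Nat.Coprimality using (prime⇒coprime; coprime-Bézout)
open import Data.Nat.GCD using (module Bézout)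
open import Data.Nat.Tactic.RingSolver using (solve-∀)
open import Data.Integer as ℤ using (ℤ; +_; +≤+; +<+; ∣_∣) renaming (_+_ to _+ℤ_; _≤_ to _≤ℤ_; _<_ to _<ℤ_)
import Data.Integer.Properties as ℤ
open import Data.Fin using (Fin; toℕ; fromℕ; fromℕ<; combine) renaming (zero to 0F; suc to sucF)
open import Data.Fin.Properties using (toℕ-injective; toℕ<n; toℕ≤pred[n]; toℕ-fromℕ; toℕ-fromℕ<; toℕ-combine; combine-surjective; _≟_)
open import Data.Product using (∃₂; ∃-syntax; _×_; _,_)
open import Data.Sum using (inj₁; inj₂)
open import Data.Empty using (⊥-elim)
open import Relation.Nullary using (yes; no)
open import Relation.Binary.PropositionalEquality using (_≡_; _≢_; refl; sym; trans; cong; cong₂; subst; subst₂; module ≡-Reasoning)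
open import Function using (_∘_; mk⇔)
open import Function.Bundles using (module Equivalence)
open import Defs

open import Algebra.Properties.AbelianGroup ℤ.+-0-abelianGroup using (xyx⁻¹≈y; ∙-cancelˡ)
open import Algebra.Properties.CommutativeSemigroup ℕ.*-commutativeSemigroup using (xy∙z≈xz∙y)

i≤j⇒∃[q]i+q≡j : ∀ {i j} → i ≤ℤ j → ∃[ q ] i +ℤ + q ≡ j
i≤j⇒∃[q]i+q≡j {i} {j} i≤j = ∣ j ℤ.- i ∣ , (begin
  i +ℤ + ∣ j ℤ.- i ∣   ≡⟨ cong (i +ℤ_) (ℤ.0≤i⇒+∣i∣≡i (ℤ.i≤j⇒0≤j-i i≤j)) ⟩
  i +ℤ (j ℤ.- i)       ≡⟨ ℤ.+-assoc i j (ℤ.- i) ⟨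
  i +ℤ j ℤ.- i         ≡⟨ xyx⁻¹≈y i j ⟩
  j                    ∎)
  where open ≡-Reasoning

i<j⇒∃[d]i+[1+d]≡j : ∀ {i j} → i <ℤ j → ∃[ d ] i +ℤ + suc d ≡ j
i<j⇒∃[d]i+[1+d]≡j i<j with i≤j⇒∃[q]i+q≡j (ℤ.<⇒≤ i<j)
... | zero  , refl = ⊥-elim (ℤ.<-irrefl (sym (ℤ.+-identityʳ _)) i<j)
... | suc d , refl = d , refl

i+m≡i+n⇒m≡n : ∀ i {m n} → i +ℤ + m ≡ i +ℤ + n → m ≡ n
i+m≡i+n⇒m≡n i {m} {n} eq = ℤ.+-injective (∙-cancelˡ i (+ m) (+ n) eq)

i+m≤i+n⇒m≤n : ∀ i {m n} → i +ℤ + m ≤ℤ i +ℤ + n → m ≤ n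
i+m≤i+n⇒m≤n i le = ℕ.≮⇒≥ (λ n<m → ℤ.<⇒≱ (ℤ.+-monoʳ-< i (+<+ n<m)) le)

i+m+1≡i+[1+m] : ∀ i m → i +ℤ + m +ℤ ℤ.1ℤ ≡ i +ℤ + suc m
i+m+1≡i+[1+m] i m = trans (ℤ.+-assoc i (+ m) ℤ.1ℤ) (cong (λ k → i +ℤ + k) (ℕ.+-comm m 1))

[m+kn]/n≡k : ∀ m k {n} .{{_ : NonZero n}} → m < n → (m + k * n) / n ≡ k
[m+kn]/n≡k m k {n} m<n = begin
  (m + k * n) / n     ≡⟨ +-distrib-/-∣ʳ m (n∣m*n k) ⟩
  m / n + k * n / n   ≡⟨ cong₂ _+_ (m<n⇒m/n≡0 m<n) (m*n/n≡m k n) ⟩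
  k                   ∎
  where open ≡-Reasoning

module RowMajor {a} {A : Set a} (D : ℕ) (F : ℕ → ℕ → A) where

  walk : ℕ → A
  walk x = F (x / suc D) (x % suc D)

  walk-at : ∀ r q → q < suc D → walk (q + r * suc D) ≡ F r q
  walk-at r q q<L = cong₂ F ([m+kn]/n≡k q r q<L) (trans ([m+kn]%n≡m%n q r (suc D)) (m<n⇒m%n≡m q<L))

  walk-step : ∀ {ℓ} (R : A → A → Set ℓ) →
              (∀ r q → q < D → R (F r q) (F r (suc q))) → (∀ r → R (F r D) (F (suc r) 0)) →
              ∀ x → R (walk x) (walk (suc x))
  walk-step R along wrap x =
    subst (λ y → R (walk y) (walk (suc y))) (sym (m≡m%n+[m/n]*n x (suc D)))
      (step (x / suc D) (x % suc D) (m%n<n x (suc D)))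
    where
    step : ∀ r q → q < suc D → R (walk (q + r * suc D)) (walk (suc (q + r * suc D)))
    step r q q<L with ℕ.m<1+n⇒m<n∨m≡n q<L
    ... | inj₁ q<D  = subst₂ R (sym (walk-at r q q<L)) (sym (walk-at r (suc q) (s≤s q<D))) (along r q q<D)
    ... | inj₂ refl = subst₂ R (sym (walk-at r D q<L)) (sym (walk-at (suc r) 0 z<s)) (wrap r)

closed-walk-cycSucc : ∀ {a} {A : Set a} {n} (f : ℕ → A) → f (suc n) ≡ f 0 →
                      ∀ (i : Fin (suc n)) → f (toℕ (cycSucc i)) ≡ f (suc (toℕ i))
closed-walk-cycSucc {n = n} f closed i with ℕ.m≤n⇒m<n∨m≡n (toℕ≤pred[n] i)
... | inj₁ i<n  = cong f (trans (toℕ-fromℕ< _) (m≤n⇒m%n≡m i<n))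
... | inj₂ i≡n = begin
  f (toℕ (cycSucc i))      ≡⟨ cong f (toℕ-fromℕ< _) ⟩
  f (suc (toℕ i) % suc n)  ≡⟨ cong (λ x → f (suc x % suc n)) i≡n ⟩
  f (suc n % suc n)        ≡⟨ cong f (n%n≡0 (suc n)) ⟩
  f 0                      ≡⟨ closed ⟨
  f (suc n)                ≡⟨ cong (f ∘ suc) i≡n ⟨
  f (suc (toℕ i))          ∎
  where open ≡-Reasoning

toℕ-combine′ : ∀ {m n} (i : Fin m) (j : Fin n) → toℕ (combine i j) ≡ toℕ j + toℕ i * n
toℕ-combine′ {n = n} i j = begin
  toℕ (combine i j)   ≡⟨ toℕ-combine i j ⟩
  n * toℕ i + toℕ j   ≡⟨ ℕ.+-comm (n * toℕ i) (toℕ j) ⟩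
  toℕ j + n * toℕ i   ≡⟨ cong (λ x → toℕ j + x) (ℕ.*-comm n (toℕ i)) ⟩
  toℕ j + toℕ i * n   ∎
  where open ≡-Reasoning

module Multiples (n : ℕ) where

  p : ℕ
  p = suc n

  multiple : ℕ → Fin p → Fin p
  multiple r k = (r * toℕ k) mod p

  toℕ-mod : ∀ x → toℕ (x mod p) ≡ x % p
  toℕ-mod x = toℕ-fromℕ< (m%n<n x p)

  %-absorbˡ-* : ∀ x y → ((x % p) * y) % p ≡ (x * y) % p
  %-absorbˡ-* x y = begin
    ((x % p) * y) % p             ≡⟨ %-distribˡ-* (x % p) y p ⟩
    ((x % p % p) * (y % p)) % p   ≡⟨ cong (λ z → (z * (y % p)) % p) (m%n%n≡m%n x p) ⟩
    ((x % p) * (y % p)) % p       ≡⟨ %-distribˡ-* x y p ⟨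
    (x * y) % p                   ∎
    where open ≡-Reasoning

  multiple-suc : ∀ r k → multiple (suc r) k ≡ addMod (multiple r k) k
  multiple-suc r k = toℕ-injective (begin
    toℕ (multiple (suc r) k)           ≡⟨ toℕ-mod (K + r * K) ⟩
    (K + r * K) % p                    ≡⟨ cong (_% p) (ℕ.+-comm K (r * K)) ⟩
    (r * K + K) % p                    ≡⟨ %-distribˡ-+ (r * K) K p ⟩
    ((r * K) % p + K % p) % p          ≡⟨ cong (λ z → (z + K % p) % p) (m%n%n≡m%n (r * K) p) ⟨
    ((r * K) % p % p + K % p) % p      ≡⟨ %-distribˡ-+ ((r * K) % p) K p ⟨
    ((r * K) % p + K) % p              ≡⟨ cong (λ z → (z + K) % p) (toℕ-mod (r * K)) ⟨
    (toℕ (multiple r k) + K) % p       ≡⟨ toℕ-mod (toℕ (multiple r k) + K) ⟨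
    toℕ (addMod (multiple r k) k)      ∎)
    where
    open ≡-Reasoning
    K = toℕ k

  multiple-p : ∀ k → multiple p k ≡ multiple 0 k
  multiple-p k = toℕ-injective (begin
    toℕ (multiple p k)   ≡⟨ toℕ-mod (p * toℕ k) ⟩
    (p * toℕ k) % p      ≡⟨ cong (_% p) (ℕ.*-comm p (toℕ k)) ⟩
    (toℕ k * p) % p      ≡⟨ m*n%n≡0 (toℕ k) p ⟩
    0                    ∎)
    where open ≡-Reasoning

  module _ (p-prime : Prime p) where

    private
      1%p≡1 : 1 % p ≡ 1
      1%p≡1 = m<n⇒m%n≡m (nonTrivial⇒n>1 p {{prime⇒nonTrivial p-prime}})

    modular-inverse : ∀ {k} → k ≢ 0F → ∃[ j ] (j * toℕ k) % p ≡ 1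
    modular-inverse {k} k≢0
      with coprime-Bézout (prime⇒coprime p-prime {{≢-nonZero (k≢0 ∘ toℕ-injective)}} (toℕ<n k))
    ... | Bézout.-+ x y eq = y , (begin
      (y * toℕ k) % p    ≡⟨ cong (_% p) eq ⟨
      (1 + x * p) % p    ≡⟨ [m+kn]%n≡m%n 1 x p ⟩
      1 % p              ≡⟨ 1%p≡1 ⟩
      1                  ∎)
      where open ≡-Reasoning
    -- here y K ≡ -1 (mod p), so (p - 1) y = n y inverts K
    ... | Bézout.+- x y eq = n * y , (begin
      (n * y * K) % p              ≡⟨ [m+kn]%n≡m%n (n * y * K) 1 p ⟨
      (n * y * K + 1 * p) % p      ≡⟨ cong (_% p) (expand n y K) ⟩
      (n * (1 + y * K) + 1) % p    ≡⟨ cong (λ z → (n * z + 1) % p) eq ⟩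
      (n * (x * p) + 1) % p        ≡⟨ cong (_% p) (regroup n x) ⟩
      (1 + (n * x) * p) % p        ≡⟨ [m+kn]%n≡m%n 1 (n * x) p ⟩
      1 % p                        ≡⟨ 1%p≡1 ⟩
      1                            ∎)
      where
      open ≡-Reasoning
      K = toℕ k
      expand : ∀ n y K → n * y * K + 1 * suc n ≡ n * (1 + y * K) + 1
      expand = solve-∀
      regroup : ∀ n x → n * (x * suc n) + 1 ≡ 1 + (n * x) * suc n
      regroup = solve-∀

    inverse-cancel : ∀ {j K} → (j * K) % p ≡ 1 → ∀ x → (x * j * K) % p ≡ x % p
    inverse-cancel {j} {K} jK≡1 x = begin
      (x * j * K) % p               ≡⟨ cong (_% p) (ℕ.*-assoc x j K) ⟩
      (x * (j * K)) % p             ≡⟨ %-distribˡ-* x (j * K) p ⟩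
      ((x % p) * ((j * K) % p)) % p ≡⟨ cong (λ z → ((x % p) * z) % p) jK≡1 ⟩
      ((x % p) * 1) % p             ≡⟨ cong (_% p) (ℕ.*-identityʳ (x % p)) ⟩
      x % p % p                     ≡⟨ m%n%n≡m%n x p ⟩
      x % p                         ∎
      where open ≡-Reasoning

    multiple-injective : ∀ {k} → k ≢ 0F → ∀ r r' → multiple (toℕ r) k ≡ multiple (toℕ r') k → r ≡ r'
    multiple-injective {k} k≢0 r r' eq with j , jK≡1 ← modular-inverse k≢0 =
      toℕ-injective (trans (sym (undo r)) (trans (cong (λ z → (toℕ z * j) % p) eq) (undo r')))
      where
      undo : ∀ s → (toℕ (multiple (toℕ s) k) * j) % p ≡ toℕ s
      undo s = begin
        (toℕ (multiple S k) * j) % p ≡⟨ cong (λ z → (z * j) % p) (toℕ-mod (S * K)) ⟩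
        ((S * K) % p * j) % p        ≡⟨ %-absorbˡ-* (S * K) j ⟩
        (S * K * j) % p              ≡⟨ cong (_% p) (xy∙z≈xz∙y S K j) ⟩
        (S * j * K) % p              ≡⟨ inverse-cancel jK≡1 S ⟩
        S % p                        ≡⟨ m<n⇒m%n≡m (toℕ<n s) ⟩
        S                            ∎
        where
        open ≡-Reasoning
        S = toℕ s
        K = toℕ k

    multiple-surjective : ∀ {k} → k ≢ 0F → ∀ l → ∃[ r ] multiple (toℕ r) k ≡ l
    multiple-surjective {k} k≢0 l with j , jK≡1 ← modular-inverse k≢0 = (toℕ l * j) mod p , toℕ-injective (begin
      toℕ (multiple (toℕ ((l' * j) mod p)) k) ≡⟨ toℕ-mod (toℕ ((l' * j) mod p) * K) ⟩
      (toℕ ((l' * j) mod p) * K) % p          ≡⟨ cong (λ z → (z * K) % p) (toℕ-mod (l' * j)) ⟩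
      ((l' * j) % p * K) % p                  ≡⟨ %-absorbˡ-* (l' * j) K ⟩
      (l' * j * K) % p                        ≡⟨ inverse-cancel jK≡1 l' ⟩
      l' % p                                  ≡⟨ m<n⇒m%n≡m (toℕ<n l) ⟩
      l'                                      ∎)
      where
      open ≡-Reasoning
      l' = toℕ l
      K = toℕ k

module GGraph {c ℓ v e} (G : Group c ℓ) {V : Set v} (E : V → V → Set e)
              (act : Group.Carrier G → V → V) (isGGraph : Setting.IsGGraph G E act) where

  open Group G hiding (refl) renaming (sym to ≈-sym; trans to ≈-trans)
  open Setting G E act
  open Setting.IsGGraph isGGraph
  open GroupProperties G using (identityʳ-unique; inverseˡ-unique; ⁻¹-injective; ⁻¹-involutive; x∙y⁻¹≈ε⇒x≈y)

  act-∙≈ : ∀ {g h k} → g ∙ h ≈ k → ∀ x → act g (act h x) ≡ act k x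
  act-∙≈ {g} {h} gh≈k x = trans (sym (act-∙ g h x)) (act-resp gh≈k x)

  act-inverseˡ : ∀ g x → act (g ⁻¹) (act g x) ≡ x
  act-inverseˡ g x = trans (act-∙≈ (inverseˡ g) x) (act-ε x)

  act-inverseʳ : ∀ g x → act g (act (g ⁻¹) x) ≡ x
  act-inverseʳ g x = trans (act-∙≈ (inverseʳ g) x) (act-ε x)

  Orb-sym : ∀ {x y} → Orb x y → Orb y x
  Orb-sym {x} (h , h∈G' , refl) = h ⁻¹ , inv h∈G' , act-inverseˡ h x

  Orb-trans : ∀ {x y z} → Orb x y → Orb y z → Orb x z
  Orb-trans {x} (h , h∈G' , refl) (h' , h'∈G' , refl) = h' ∙ h , mul h'∈G' h∈G' , act-∙ h' h x

  InG'-conj : ∀ c {g} → InG' g → InG' (c ⁻¹ ∙ g ∙ c)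
  InG'-conj c {g} g∈G' = resp c⁻¹g⁻¹⁻¹cg⁻¹g≈c⁻¹gc (mul (comm c (g ⁻¹)) g∈G')
    where
    open import Relation.Binary.Reasoning.Setoid setoid
    c⁻¹g⁻¹⁻¹cg⁻¹g≈c⁻¹gc : c ⁻¹ ∙ g ⁻¹ ⁻¹ ∙ c ∙ g ⁻¹ ∙ g ≈ c ⁻¹ ∙ g ∙ c
    c⁻¹g⁻¹⁻¹cg⁻¹g≈c⁻¹gc = begin
      c ⁻¹ ∙ g ⁻¹ ⁻¹ ∙ c ∙ g ⁻¹ ∙ g    ≈⟨ assoc _ (g ⁻¹) g ⟩
      c ⁻¹ ∙ g ⁻¹ ⁻¹ ∙ c ∙ (g ⁻¹ ∙ g)  ≈⟨ ∙-congˡ (inverseˡ g) ⟩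
      c ⁻¹ ∙ g ⁻¹ ⁻¹ ∙ c ∙ ε           ≈⟨ identityʳ _ ⟩
      c ⁻¹ ∙ g ⁻¹ ⁻¹ ∙ c               ≈⟨ ∙-congʳ (∙-congˡ (⁻¹-involutive g)) ⟩
      c ⁻¹ ∙ g ∙ c                     ∎

  G'-fixed-invariant : ∀ {y} → (∀ {g} → InG' g → act g y ≡ y) →
                       ∀ c {g} → InG' g → act g (act c y) ≡ act c y
  G'-fixed-invariant {y} fixed c {g} g∈G' = begin
    act g (act c y)                         ≡⟨ act-inverseʳ c _ ⟨
    act c (act (c ⁻¹) (act g (act c y)))    ≡⟨ cong (act c) (act-∙ (c ⁻¹) g (act c y)) ⟨
    act c (act (c ⁻¹ ∙ g) (act c y))        ≡⟨ cong (act c) (act-∙ (c ⁻¹ ∙ g) c y) ⟨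
    act c (act (c ⁻¹ ∙ g ∙ c) y)            ≡⟨ cong (act c) (fixed (InG'-conj c g∈G')) ⟩
    act c y                                 ∎
    where open ≡-Reasoning

  module CyclicCommutator {P : ℕ} (p-prime : Prime (suc (suc P))) (transitive : Transitive)
           (φ : Fin (suc (suc P)) → Carrier) (φ∈G' : ∀ k → InG' (φ k))
           (φ-onto : ∀ g → InG' g → ∃[ k ] φ k ≈ g) (φ-injective : ∀ k k' → φ k ≈ φ k' → k ≡ k')
           (φ-hom : ∀ k k' → φ (addMod k k') ≈ φ k ∙ φ k') where

    open Multiples (suc P)

    1≢0 : sucF {suc P} 0F ≢ 0F
    1≢0 ()

    φ-0 : φ 0F ≈ ε
    φ-0 = identityʳ-unique (φ 0F) (φ 0F) (≈-sym (φ-hom 0F 0F))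

    φ-multiple-fixes : ∀ {k z} → act (φ k) z ≡ z → ∀ r → act (φ (multiple r k)) z ≡ z
    φ-multiple-fixes {k} {z} fixed zero    = trans (act-resp φ-0 z) (act-ε z)
    φ-multiple-fixes {k} {z} fixed (suc r) = begin
      act (φ (multiple (suc r) k)) z             ≡⟨ cong (λ j → act (φ j) z) (multiple-suc r k) ⟩
      act (φ (addMod (multiple r k) k)) z        ≡⟨ act-∙≈ (≈-sym (φ-hom (multiple r k) k)) z ⟨
      act (φ (multiple r k)) (act (φ k) z)       ≡⟨ cong (act (φ (multiple r k))) fixed ⟩
      act (φ (multiple r k)) z                   ≡⟨ φ-multiple-fixes fixed r ⟩
      z                                          ∎
      where open ≡-Reasoning

    G'-fixes : ∀ {k z} → k ≢ 0F → act (φ k) z ≡ z → ∀ {g} → InG' g → act g z ≡ z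
    G'-fixes {k} {z} k≢0 fixed {g} g∈G' =
      let (j , φj≈g) = φ-onto g g∈G'
          (r , rk≡j) = multiple-surjective p-prime k≢0 j
      in trans (sym (act-resp φj≈g z)) (subst (λ i → act (φ i) z ≡ z) rk≡j (φ-multiple-fixes fixed (toℕ r)))

    G'-free : ∀ {g y} → InG' g → act g y ≡ y → g ≈ ε
    G'-free {g} {y} g∈G' fixed with k , φk≈g ← φ-onto g g∈G' | k ≟ 0F
    ... | yes refl = ≈-trans (≈-sym φk≈g) φ-0
    ... | no k≢0   =
      ⊥-elim (1≢0 (φ-injective (sucF 0F) 0F (≈-trans (act-inj (φ (sucF 0F)) ε acts-trivially) (≈-sym φ-0))))
      where
      acts-trivially : ∀ z → act (φ (sucF 0F)) z ≡ act ε z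
      acts-trivially z with c , refl ← transitive y z =
        trans (G'-fixed-invariant (G'-fixes k≢0 (trans (act-resp φk≈g y) fixed)) c (φ∈G' (sucF 0F))) (sym (act-ε _))

    φ-act-injective : ∀ {k k' y} → act (φ k) y ≡ act (φ k') y → k ≡ k'
    φ-act-injective {k} {k'} {y} eq =
      φ-injective k k' (x∙y⁻¹≈ε⇒x≈y (φ k) (φ k') (G'-free (mul (φ∈G' k) (inv (φ∈G' k'))) fixed))
      where
      fixed : act (φ k ∙ φ k' ⁻¹) (act (φ k') y) ≡ act (φ k') y
      fixed = trans (act-∙ (φ k) (φ k' ⁻¹) _) (trans (cong (act (φ k)) (act-inverseˡ (φ k') y)) eq)

    bouncing⇒jumps : IsSimpleGraph E → ∀ {vs a b} → Bouncing vs a b →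
                     ∃[ m ] m ≢ 0F × (∀ k → E (act (φ k) (vs b)) (act (φ (addMod k m)) (vs a)))
    bouncing⇒jumps simple {vs} {a} {b} (_ , _ , (h , h' , h∈G' , h'∈G' , h≉h' , refl , refl) , edge)
      with m , φm≈h'⁻¹h ← φ-onto (h' ⁻¹ ∙ h) (mul (inv h'∈G') h∈G') = m , m≢0 , jump
      where
      open import Relation.Binary.Reasoning.Setoid setoid
      m≢0 : m ≢ 0F
      m≢0 refl = h≉h' (≈-sym (⁻¹-injective (inverseˡ-unique (h' ⁻¹) h (≈-trans (≈-sym φm≈h'⁻¹h) φ-0))))
      jump : ∀ k → E (act (φ k) (vs b)) (act (φ (addMod k m)) (vs a))
      jump k = IsSimpleGraph.sym simple
        (subst₂ E (act-∙≈ to-a (vs a)) (act-∙≈ to-b (vs b)) (Equivalence.to (act-adj (φ k ∙ h' ⁻¹)) edge))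
        where
        to-a : φ k ∙ h' ⁻¹ ∙ h ≈ φ (addMod k m)
        to-a = begin
          φ k ∙ h' ⁻¹ ∙ h     ≈⟨ assoc (φ k) (h' ⁻¹) h ⟩
          φ k ∙ (h' ⁻¹ ∙ h)   ≈⟨ ∙-congˡ φm≈h'⁻¹h ⟨
          φ k ∙ φ m           ≈⟨ φ-hom k m ⟨
          φ (addMod k m)      ∎
        to-b : φ k ∙ h' ⁻¹ ∙ h' ≈ φ k
        to-b = begin
          φ k ∙ h' ⁻¹ ∙ h'    ≈⟨ assoc (φ k) (h' ⁻¹) h' ⟩
          φ k ∙ (h' ⁻¹ ∙ h')  ≈⟨ ∙-congˡ (inverseˡ h') ⟩
          φ k ∙ ε             ≈⟨ identityʳ (φ k) ⟩
          φ k                 ∎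

    module Block (w : ℤ → V) (path : IsTwoWayHamPathQ w) (vs : ℤ → V) (lifting : IsLifting w vs)
                 (a : ℤ) (d : ℕ) {m : Fin p} (m≢0 : m ≢ 0F)
                 (jump : ∀ k → E (act (φ k) (vs (a +ℤ + suc d))) (act (φ (addMod k m)) (vs a))) where

      open IsTwoWayHamPathQ path using (distinct)
      open IsLifting lifting using (inFibre) renaming (adjacent to lift-adjacent)

      L : ℕ
      L = suc (suc d)

      -- u ^ r v_(a+q) for u = φ m
      vertex : ℕ → ℕ → V
      vertex r q = act (φ (multiple r m)) (vs (a +ℤ + q))

      open RowMajor (suc d) vertex

      vertex-along : ∀ r q → q < suc d → E (vertex r q) (vertex r (suc q))
      vertex-along r q _ = Equivalence.to (act-adj (φ (multiple r m)))
        (subst (λ i → E (vs (a +ℤ + q)) (vs i)) (i+m+1≡i+[1+m] a q) (lift-adjacent (a +ℤ + q)))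

      vertex-wrap : ∀ r → E (vertex r (suc d)) (vertex (suc r) 0)
      vertex-wrap r = subst₂ (λ j i → E (vertex r (suc d)) (act (φ j) (vs i)))
        (sym (multiple-suc r m)) (sym (ℤ.+-identityʳ a)) (jump (multiple r m))

      walk-closed : walk (p * L) ≡ walk 0
      walk-closed = begin
        walk (0 + p * L)   ≡⟨ walk-at p 0 z<s ⟩
        vertex p 0         ≡⟨ cong (λ j → act (φ j) (vs (a +ℤ + 0))) (multiple-p m) ⟩
        vertex 0 0         ≡⟨ walk-at 0 0 z<s ⟨
        walk (0 + 0 * L)   ∎
        where open ≡-Reasoning

      cycle : Fin (p * L) → V
      cycle i = walk (toℕ i)

      cycle-combine : ∀ (r : Fin p) (q : Fin L) → cycle (combine r q) ≡ vertex (toℕ r) (toℕ q)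
      cycle-combine r q = trans (cong walk (toℕ-combine′ r q)) (walk-at (toℕ r) (toℕ q) (toℕ<n q))

      vertex-in-fibre : ∀ r q → Orb (w (a +ℤ + q)) (vertex r q)
      vertex-in-fibre r q = Orb-trans (inFibre (a +ℤ + q)) (φ (multiple r m) , φ∈G' (multiple r m) , refl)

      vertex-fibre-injective : ∀ r r' {q q'} → vertex r q ≡ vertex r' q' → q ≡ q'
      vertex-fibre-injective r r' {q} {q'} eq = i+m≡i+n⇒m≡n a (distinct _ _
        (Orb-trans (vertex-in-fibre r q) (subst (λ x → Orb x (w (a +ℤ + q'))) (sym eq) (Orb-sym (vertex-in-fibre r' q')))))

      vertex-injective : ∀ r r' q q' → vertex (toℕ r) q ≡ vertex (toℕ r') q' → r ≡ r' × q ≡ q'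
      vertex-injective r r' q q' eq with refl ← vertex-fibre-injective (toℕ r) (toℕ r') eq =
        multiple-injective p-prime m≢0 r r' (φ-act-injective eq) , refl

      vertex-in-block : ∀ r (q : Fin L) → InBlock w a (a +ℤ + suc d) (vertex r (toℕ q))
      vertex-in-block r q =
        a +ℤ + toℕ q , ℤ.i≤i+j a (+ toℕ q) , ℤ.+-monoʳ-≤ a (+≤+ (toℕ≤pred[n] q)) , vertex-in-fibre r (toℕ q)

      block-vertex : ∀ {x} → InBlock w a (a +ℤ + suc d) x → ∃₂ λ r q → vertex (toℕ r) (toℕ q) ≡ x
      block-vertex (i , a≤i , i≤b , orbit) with q , refl ← i≤j⇒∃[q]i+q≡j a≤i
        with g , g∈G' , refl ← Orb-trans (Orb-sym (inFibre (a +ℤ + q))) orbit =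
        let (k , φk≈g) = φ-onto g g∈G'
            (r , rm≡k) = multiple-surjective p-prime m≢0 k
            q<L = s≤s (i+m≤i+n⇒m≤n a i≤b)
        in r , fromℕ< q<L , (begin
          vertex (toℕ r) (toℕ (fromℕ< q<L))     ≡⟨ cong (vertex (toℕ r)) (toℕ-fromℕ< q<L) ⟩
          act (φ (multiple (toℕ r) m)) (vs _)   ≡⟨ cong (λ j → act (φ j) (vs _)) rm≡k ⟩
          act (φ k) (vs _)                      ≡⟨ act-resp φk≈g _ ⟩
          act g (vs (a +ℤ + q))                 ∎)
        where open ≡-Reasoning

      cycle-in-block : ∀ i → InBlock w a (a +ℤ + suc d) (cycle i)
      cycle-in-block i with r , q , refl ← combine-surjective {p} {L} i =
        subst (InBlock w a (a +ℤ + suc d)) (sym (cycle-combine r q)) (vertex-in-block (toℕ r) q)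

      block-in-cycle : ∀ {x} → InBlock w a (a +ℤ + suc d) x → ∃[ i ] cycle i ≡ x
      block-in-cycle x∈B with r , q , eq ← block-vertex x∈B = combine r q , trans (cycle-combine r q) eq

      cycle-injective : ∀ i j → cycle i ≡ cycle j → i ≡ j
      cycle-injective i j eq
        with r , q , refl ← combine-surjective {p} {L} i | r' , q' , refl ← combine-surjective {p} {L} j
        with r≡r' , q≡q' ← vertex-injective r r' (toℕ q) (toℕ q')
                             (trans (sym (cycle-combine r q)) (trans eq (cycle-combine r' q')))
        = cong₂ combine r≡r' (toℕ-injective q≡q')

      cycle-edge : ∀ i → E (cycle i) (cycle (cycSucc i))
      cycle-edge i = subst (E (cycle i)) (sym (closed-walk-cycSucc walk walk-closed i))
        (walk-step E vertex-along vertex-wrap (toℕ i))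

      exit₀ : Fin (p * L)
      exit₀ = combine {p} 0F (fromℕ (suc d))

      cycle-exit₀ : cycle exit₀ ≡ vertex 0 (suc d)
      cycle-exit₀ = trans (cycle-combine 0F (fromℕ (suc d))) (cong (vertex 0) (toℕ-fromℕ (suc d)))

      cycle-after-exit₀ : cycle (cycSucc exit₀) ≡ vertex 1 0
      cycle-after-exit₀ = begin
        cycle (cycSucc exit₀)                     ≡⟨ closed-walk-cycSucc walk walk-closed exit₀ ⟩
        walk (suc (toℕ exit₀))                    ≡⟨ cong (walk ∘ suc) (toℕ-combine′ {p} 0F (fromℕ (suc d))) ⟩
        walk (suc (toℕ (fromℕ (suc d)) + 0 * L))  ≡⟨ cong (λ q → walk (suc (q + 0 * L))) (toℕ-fromℕ (suc d)) ⟩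
        walk (0 + 1 * L)                          ≡⟨ walk-at 1 0 z<s ⟩
        vertex 1 0                                ∎
        where open ≡-Reasoning

      exit₀-bouncing : BouncingEdge vs a (a +ℤ + suc d) (cycle (cycSucc exit₀)) (cycle exit₀)
      exit₀-bouncing = φ (multiple 1 m) , φ (multiple 0 m) , φ∈G' (multiple 1 m) , φ∈G' (multiple 0 m) ,
        (λ eq → 1≢0 (multiple-injective p-prime m≢0 (sucF 0F) 0F (φ-injective _ _ eq))) ,
        trans (cong (act (φ (multiple 1 m)) ∘ vs) (sym (ℤ.+-identityʳ a))) (sym cycle-after-exit₀) ,
        sym cycle-exit₀

      hamCycle : HamCycleWithBouncing w vs a (a +ℤ + suc d)
      hamCycle = record
        { n         = p * L
        ; n≥3       = ℕ.≤-trans (ℕ.n≤1+n 3) (ℕ.*-mono-≤ (ℕ.m≤m+n 2 P) (ℕ.m≤m+n 2 d))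
        ; cyc       = cycle
        ; injective = cycle-injective
        ; spans     = λ x → mk⇔ block-in-cycle λ { (i , refl) → cycle-in-block i }
        ; edges     = cycle-edge
        ; bouncing  = exit₀ , inj₂ exit₀-bouncing
        }

    blockHamCycle : IsSimpleGraph E → ∀ {w vs} → IsTwoWayHamPathQ w → IsLifting w vs →
                    ∀ {a b} → a <ℤ b → Bouncing vs a b → HamCycleWithBouncing w vs a b
    blockHamCycle simple {w} {vs} path lifting {a} a<b bouncing with d , refl ← i<j⇒∃[d]i+[1+d]≡j a<b
      with m , m≢0 , jump ← bouncing⇒jumps simple {vs} bouncing = Block.hamCycle w path vs lifting a d m≢0 jump

mainTheorem11 : ∀ {c ℓ v e} (p : ℕ) → Prime p →
    (G : Group c ℓ) (V : Set v) (E : V → V → Set e) (act : Group.Carrier G → V → V) →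
    IsSimpleGraph E → Infinite V →
    Setting.IsGGraph G E act → Setting.Transitive G E act →
    Setting.G'≅ℤ G E act p →
    (w : ℤ → V) → Setting.IsTwoWayHamPathQ G E act w →
    (vs : ℤ → V) → Setting.IsLifting G E act w vs →
    (s t : ℤ → ℤ) → Setting.IsAligned G E act w s t →
    (∀ l → Setting.Bouncing G E act vs (s l) (t l)) →
    ∀ l → Setting.HamCycleWithBouncing G E act w vs (s l) (t l)
mainTheorem11 zero          p-prime = ⊥-elim (¬prime[0] p-prime)
mainTheorem11 (suc zero)    p-prime = ⊥-elim (¬prime[1] p-prime)
mainTheorem11 (suc (suc P)) p-prime G V E act simple _ isGGraph transitive (φ , φ∈G' , φ-onto , φ-injective , φ-hom)
              w path vs lifting s t aligned bouncing l =
  blockHamCycle simple path lifting (Setting.IsAligned.forward aligned l) (bouncing l)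
  where
  open GGraph G E act isGGraph
  open CyclicCommutator p-prime transitive φ φ∈G' φ-onto φ-injective φ-hom
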